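{- Let $k\ge j\ge 1$ be integers and let $c_{k,j}(n)$ denote the number of $(k,j)$-colored partitions of $n$. Then \[ \sum_{n=0}^\infty c_{k,j}(n) q^n = \prod_{n=1}^\infty \left( 1 + \frac{\binom{k}{1} q^n}{1-q^n} + \frac{\binom{k}{2} q^{2n}}{(1-q^{n})^2} + \dots + \frac{\binom{k}{j}q^{jn}}{(1-q^n)^j} \right) = \frac{1}{(q;q)_\infty^j} \prod_{n=1}^\infty \left( \sum_{i=0}^j \binom{k}{i} (1-q^n)^{j-i} q^{in} \right) = \frac{1}{(q;q)_\infty^j} \prod_{n=1}^\infty \left( \sum_{i=0}^j \binom{k-j+i-1}{i} q^{i n} \right). \]
   Context: A $k$-colored partition of $n$ is a multiset of colored parts $a_b$ with $a$ a positive integer (the size) and $b\in\{1,\dots,k\}$ (the color), whose sizes sum to $n$; order is irrelevant (equivalently, listed weakly decreasingly, ordering first by size then by color). A $(k,j)$-colored partition of $n$ is a $k$-colored partition of $n$ in which, for each part size, at most $j$ distinct colors appear among the parts of that size. $(q;q)_\infty=\prod_{n\ge1}(1-q^n)$. -}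

module Defs where

open import Data.Bool using (Bool; if_then_else_)
open import Data.Nat as ℕ using (ℕ; zero; suc; _∸_; _<_; _≤_)
open import Data.Nat.Combinatorics using (_C_)
open import Data.Nat.Divisibility using (_∣?_)
open import Data.Integer as ℤ using (ℤ; +_)
open import Data.List using (List; []; _∷_; map; filter; length; deduplicate)
open import Data.Nat.ListAction using (sum)
open import Data.List.Relation.Unary.All using (All)
open import Data.List.Relation.Unary.Linked using (Linked)
open import Data.Fin as Fin using (Fin; toℕ)
open import Data.Product using (_×_; _,_; proj₁; proj₂)
open import Data.Sum using (_⊎_)
open import Relation.Binary.PropositionalEquality using (_≡_)
open import Relation.Nullary.Decidable using (⌊_⌋)

-- Formal power series over ℤ: the coefficient sequence.

PS : Set
PS = ℕ → ℤ

sumℤ : ℕ → (ℕ → ℤ) → ℤ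
sumℤ zero    f = + 0
sumℤ (suc n) f = sumℤ n f ℤ.+ f n

zeroₚ : PS
zeroₚ _ = + 0

qpow : ℕ → PS
qpow n m = if ⌊ m ℕ.≟ n ⌋ then + 1 else + 0

oneₚ : PS
oneₚ = qpow 0

_+ₚ_ : PS → PS → PS
(f +ₚ g) m = f m ℤ.+ g m

_-ₚ_ : PS → PS → PS
(f -ₚ g) m = f m ℤ.- g m

_·ₚ_ : ℤ → PS → PS
(c ·ₚ f) m = c ℤ.* f m

_*ₚ_ : PS → PS → PS
(f *ₚ g) m = sumℤ (suc m) (λ i → f i ℤ.* g (m ∸ i))

_^ₚ_ : PS → ℕ → PS
f ^ₚ zero    = oneₚ
f ^ₚ suc i   = f *ₚ (f ^ₚ i)

sumₚ : ℕ → (ℕ → PS) → PS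
sumₚ j F m = sumℤ (suc j) (λ i → F i m)

-- 1/(1-q^n) for n ≥ 1, i.e. the geometric series Σ_{t≥0} q^{tn}
-- (the inverse of 1 - q^n in ℤ[[q]]).
invOneMinusQ : ℕ → PS
invOneMinusQ n m = if ⌊ n ∣? m ⌋ then + 1 else + 0

finProd : (ℕ → PS) → ℕ → PS
finProd F zero    = oneₚ
finProd F (suc N) = finProd F N *ₚ F (suc N)

-- Infinite product ∏_{n≥1} F n, for factors with F n ≡ 1 (mod q^n)
-- (all factors used below are of this form): the coefficient of q^N
-- stabilises from the N-th partial product on.
infProd : (ℕ → PS) → PS
infProd F N = finProd F N N

invPoch : PS
invPoch = infProd invOneMinusQ

factor1 : ℕ → ℕ → ℕ → PS
factor1 k j n = sumₚ j (λ i → (+ (k C i)) ·ₚ (qpow (i ℕ.* n) *ₚ (invOneMinusQ n ^ₚ i)))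

factor2 : ℕ → ℕ → ℕ → PS
factor2 k j n = sumₚ j (λ i → (+ (k C i)) ·ₚ (((oneₚ -ₚ qpow n) ^ₚ (j ∸ i)) *ₚ qpow (i ℕ.* n)))

factor3 : ℕ → ℕ → ℕ → PS
factor3 k j n = sumₚ j (λ i → (+ ((((k ∸ j) ℕ.+ i) ∸ 1) C i)) ·ₚ qpow (i ℕ.* n))

-- a colored part a_b : size a, color b ∈ {1..k} (represented by Fin k)
Part : ℕ → Set
Part k = ℕ × Fin k

_≽_ : ∀ {k} → Part k → Part k → Set
(a , b) ≽ (a′ , b′) = a′ < a ⊎ (a′ ≡ a × toℕ b′ ≤ toℕ b)

colorsOfSize : ∀ {k} → ℕ → List (Part k) → List (Fin k)
colorsOfSize a l = map proj₂ (filter (λ p → proj₁ p ℕ.≟ a) l)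

numColors : ∀ {k} → ℕ → List (Part k) → ℕ
numColors a l = length (deduplicate Fin._≟_ (colorsOfSize a l))

-- A (k,j)-colored partition of n: a weakly decreasing list of colored parts
-- (canonical representative of the multiset) with positive sizes summing to n,
-- using at most j distinct colors for each part size.  Proof fields are
-- irrelevant, so two such partitions are equal iff their part lists are.
record KJPartition (k j n : ℕ) : Set where
  field
    parts : List (Part k)
    .positive   : All (λ p → 1 ≤ proj₁ p) parts
    .decreasing : Linked _≽_ parts
    .sizeSum    : sum (map proj₁ parts) ≡ n
    .colorBound : ∀ a → numColors a parts ≤ j

module Submission where

-- Since 1/(1-q^n) is the inverse
-- of 1 - q^n, clearing denominators gives factor1 = (1-q^n)^{-j} · factor2,
-- and a double Pascal recurrence in k and j turns factor2 into factor3;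
-- these yield the two product forms.
--
-- For the count we build (k,j)-coloured partitions size by size and, within
-- the top size n, colour by colour: the partial partitions ("stages") with
-- top size n, colours < c and at most j′ colours at the top satisfy
--   stages(n, c+1, j′+1) ≅ stages(n, c, j′+1) ⊎ (run of n_c) × stages(n, c, j′),
-- an explicit bijection.  Counting through it gives a natural number m with
-- Fin m ↔ KJPartition k j N, and its generating function obeys the Pascal
-- recurrence factor1(c+1, j′+1) = factor1(c, j′+1) + q^n/(1-q^n) · factor1(c, j′);
-- hence the stages of level N are counted by the N-th partial product.

open import Defs
open import Algebra.Bundles using (CommutativeRing)
open import Algebra.Structures using (IsCommutativeRing)
import Algebra.Properties.CommutativeSemigroup as CommSemigroupProperties
import Algebra.Properties.Ring as RingProperties
open import Data.Bool using (if_then_else_)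
open import Data.Empty using (⊥; ⊥-elim)
import Data.Empty.Irrelevant as Irrelevant
open import Data.Fin as Fin using (Fin; toℕ; fromℕ<)
import Data.Fin.Properties as FinP
open import Data.Integer as ℤ using (ℤ; +_)
import Data.Integer.Properties as ℤP
open import Data.Integer.Tactic.RingSolver using (solve-∀)
open import Data.List using (List; []; _∷_; _++_; map; filter; length; deduplicate; replicate)
open import Data.List.Membership.Propositional using (_∈_; _∉_)
import Data.List.Membership.Propositional.Properties as Membership
import Data.List.Properties as ListP
open import Data.List.Relation.Unary.All as All using (All; []; _∷_)
import Data.List.Relation.Unary.All.Properties as AllP
open import Data.List.Relation.Unary.Linked as Linked using (Linked; []; [-]; _∷_)
open import Data.List.Relation.Unary.Linked.Properties using (Linked⇒All)
open import Data.Nat as ℕ using (ℕ; zero; suc; _∸_; _<_; _≤_; z≤n; s≤s)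
open import Data.Nat.Combinatorics using (_C_; nCk+nC[k+1]≡[n+1]C[k+1])
open import Data.Nat.Divisibility using (_∣_; _∣?_; divides; ∣m∸n∣n⇒∣m; ∣m+n∣m⇒∣n; ∣-refl; ∣⇒≤; _∣0)
open import Data.Nat.ListAction using (sum)
import Data.Nat.Properties as ℕP
open import Data.Product using (Σ; _×_; _,_; proj₁; proj₂)
open import Data.Product.Function.NonDependent.Propositional using (_×-↔_)
open import Data.Product.Properties using (≡-dec)
open import Data.Sum using (_⊎_; inj₁; inj₂)
open import Data.Sum.Function.Propositional using (_⊎-↔_)
open import Data.Unit using (⊤; tt)
open import Function using (_∘_; _∋_)
open import Function.Bundles using (_↔_; mk↔ₛ′)
open import Function.Properties.Inverse using (↔-trans; ↔-sym)
open import Relation.Binary.Definitions using (tri<; tri≈; tri>)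
open import Relation.Binary.PropositionalEquality
open import Relation.Binary.Structures using (IsEquivalence)
import Relation.Binary.Reasoning.Setoid as SetoidReasoning
open import Relation.Nullary using (Dec; yes; no)
open import Relation.Nullary.Decidable using (⌊_⌋; recompute; ¬?)

module FiniteSums where
  open import Data.Integer using (_+_; _*_)

  sumℤ-cong : ∀ n {f g : ℕ → ℤ} → (∀ i → i < n → f i ≡ g i) → sumℤ n f ≡ sumℤ n g
  sumℤ-cong zero    eq = refl
  sumℤ-cong (suc n) eq =
    cong₂ _+_ (sumℤ-cong n (λ i i<n → eq i (ℕP.m<n⇒m<1+n i<n))) (eq n ℕP.≤-refl)

  sumℤ-zero : ∀ n (f : ℕ → ℤ) → (∀ i → i < n → f i ≡ + 0) → sumℤ n f ≡ + 0
  sumℤ-zero zero    f vanish = refl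
  sumℤ-zero (suc n) f vanish =
    cong₂ _+_ (sumℤ-zero n f (λ i i<n → vanish i (ℕP.m<n⇒m<1+n i<n))) (vanish n ℕP.≤-refl)

  sumℤ-+ : ∀ n (f g : ℕ → ℤ) → sumℤ n (λ i → f i + g i) ≡ sumℤ n f + sumℤ n g
  sumℤ-+ zero    f g = refl
  sumℤ-+ (suc n) f g =
    trans (cong (_+ (f n + g n)) (sumℤ-+ n f g)) (interchange (sumℤ n f) (sumℤ n g) (f n) (g n))
    where interchange : ∀ a b c d → (a + b) + (c + d) ≡ (a + c) + (b + d)
          interchange = solve-∀

  sumℤ-*ˡ : ∀ n c (f : ℕ → ℤ) → c * sumℤ n f ≡ sumℤ n (λ i → c * f i)
  sumℤ-*ˡ zero    c f = ℤP.*-zeroʳ c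
  sumℤ-*ˡ (suc n) c f =
    trans (ℤP.*-distribˡ-+ c (sumℤ n f) (f n)) (cong (_+ (c * f n)) (sumℤ-*ˡ n c f))

  sumℤ-*ʳ : ∀ n c (f : ℕ → ℤ) → sumℤ n f * c ≡ sumℤ n (λ i → f i * c)
  sumℤ-*ʳ n c f = trans (ℤP.*-comm (sumℤ n f) c)
    (trans (sumℤ-*ˡ n c f) (sumℤ-cong n (λ i _ → ℤP.*-comm c (f i))))

  sumℤ-head : ∀ n (f : ℕ → ℤ) → sumℤ (suc n) f ≡ f 0 + sumℤ n (f ∘ suc)
  sumℤ-head zero    f = trans (ℤP.+-identityˡ (f 0)) (sym (ℤP.+-identityʳ (f 0)))
  sumℤ-head (suc n) f = trans (cong (_+ f (suc n)) (sumℤ-head n f))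
                              (ℤP.+-assoc (f 0) (sumℤ n (f ∘ suc)) (f (suc n)))

  sumℤ-reverse : ∀ n (f : ℕ → ℤ) → sumℤ n f ≡ sumℤ n (λ i → f (n ∸ suc i))
  sumℤ-reverse zero    f = refl
  sumℤ-reverse (suc n) f = begin
      sumℤ n f + f n                          ≡⟨ cong (_+ f n) (sumℤ-reverse n f) ⟩
      sumℤ n (λ i → f (n ∸ suc i)) + f n      ≡⟨ ℤP.+-comm (sumℤ n (λ i → f (n ∸ suc i))) (f n) ⟩
      f n + sumℤ n (λ i → f (n ∸ suc i))      ≡⟨ sym (sumℤ-head n (λ i → f (suc n ∸ suc i))) ⟩
      sumℤ (suc n) (λ i → f (suc n ∸ suc i))  ∎
    where open ≡-Reasoning

  sumℤ-swap : ∀ n m (F : ℕ → ℕ → ℤ) →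
    sumℤ n (λ i → sumℤ m (F i)) ≡ sumℤ m (λ l → sumℤ n (λ i → F i l))
  sumℤ-swap zero    m F = sym (sumℤ-zero m _ (λ _ _ → refl))
  sumℤ-swap (suc n) m F = trans (cong (_+ sumℤ m (F n)) (sumℤ-swap n m F))
                                (sym (sumℤ-+ m (λ l → sumℤ n (λ i → F i l)) (F n)))

  sumℤ-triangle : ∀ m (F : ℕ → ℕ → ℤ) →
    sumℤ (suc m) (λ i → sumℤ (suc i) (λ a → F a i)) ≡
    sumℤ (suc m) (λ a → sumℤ (suc (m ∸ a)) (λ b → F a (a ℕ.+ b)))
  sumℤ-triangle zero    F = refl
  sumℤ-triangle (suc m) F = begin
      sumℤ (suc m) (λ i → sumℤ (suc i) (λ a → F a i)) + column
    ≡⟨ cong (_+ column) (sumℤ-triangle m F) ⟩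
      rows m + (sumℤ (suc m) (λ a → F a (suc m)) + F (suc m) (suc m))
    ≡⟨ sym (ℤP.+-assoc (rows m) (sumℤ (suc m) (λ a → F a (suc m))) (F (suc m) (suc m))) ⟩
      (rows m + sumℤ (suc m) (λ a → F a (suc m))) + F (suc m) (suc m)
    ≡⟨ cong₂ _+_ (sym (sumℤ-+ (suc m) _ _)) lastRow ⟩
      sumℤ (suc m) (λ a → row m a + F a (suc m)) + row (suc m) (suc m)
    ≡⟨ cong (_+ row (suc m) (suc m)) (sumℤ-cong (suc m) extendRow) ⟩
      sumℤ (suc m) (row (suc m)) + row (suc m) (suc m)
    ∎
    where
    open ≡-Reasoning
    column : ℤ
    column = sumℤ (suc (suc m)) (λ a → F a (suc m))
    row : ℕ → ℕ → ℤ
    row l a = sumℤ (suc (l ∸ a)) (λ b → F a (a ℕ.+ b))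
    rows : ℕ → ℤ
    rows l = sumℤ (suc l) (row l)
    lastRow : F (suc m) (suc m) ≡ row (suc m) (suc m)
    lastRow rewrite ℕP.n∸n≡0 m | ℕP.+-identityʳ m = sym (ℤP.+-identityˡ _)
    extendRow : ∀ a → a < suc m → row m a + F a (suc m) ≡ row (suc m) a
    extendRow a a<sm = begin
        row m a + F a (suc m)
      ≡⟨ cong (λ x → row m a + F a x) (sym a+[1+m∸a]≡1+m) ⟩
        sumℤ (suc (suc (m ∸ a))) (λ b → F a (a ℕ.+ b))
      ≡⟨ cong (λ x → sumℤ (suc x) (λ b → F a (a ℕ.+ b))) (sym 1+m∸a≡1+[m∸a]) ⟩
        row (suc m) a
      ∎
      where
      1+m∸a≡1+[m∸a] : suc m ∸ a ≡ suc (m ∸ a)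
      1+m∸a≡1+[m∸a] = ℕP.+-∸-assoc 1 (ℕP.≤-pred a<sm)
      a+[1+m∸a]≡1+m : a ℕ.+ suc (m ∸ a) ≡ suc m
      a+[1+m∸a]≡1+m = trans (cong (a ℕ.+_) (sym 1+m∸a≡1+[m∸a])) (ℕP.m+[n∸m]≡n (ℕP.<⇒≤ a<sm))

  sumℤ-single : ∀ n a (g : ℕ → ℤ) → a < n → (∀ i → i < n → i ≢ a → g i ≡ + 0) →
    sumℤ n g ≡ g a
  sumℤ-single (suc n) a g a<1+n vanish with ℕP.m≤n⇒m<n∨m≡n (ℕP.≤-pred a<1+n)
  ... | inj₁ a<n  = begin
      sumℤ n g + g n  ≡⟨ cong₂ _+_ (sumℤ-single n a g a<n vanish′) (vanish n ℕP.≤-refl (ℕP.>⇒≢ a<n)) ⟩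
      g a + + 0       ≡⟨ ℤP.+-identityʳ (g a) ⟩
      g a             ∎
    where open ≡-Reasoning
          vanish′ : ∀ i → i < n → i ≢ a → g i ≡ + 0
          vanish′ i i<n = vanish i (ℕP.m<n⇒m<1+n i<n)
  ... | inj₂ refl = begin
      sumℤ n g + g n  ≡⟨ cong (_+ g n) (sumℤ-zero n g (λ i i<n → vanish i (ℕP.m<n⇒m<1+n i<n) (ℕP.<⇒≢ i<n))) ⟩
      + 0 + g n       ≡⟨ ℤP.+-identityˡ (g n) ⟩
      g n             ∎
    where open ≡-Reasoning

open FiniteSums

-- Coefficientwise equality of power series.  It is a record so that the
-- two series can be inferred from a proof of it.
infix 4 _≈_
record _≈_ (f g : PS) : Set where
  constructor mk≈
  field coeff : ∀ m → f m ≡ g m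
open _≈_

module PowerSeriesRing where
  open import Data.Integer using (_+_; _*_; -_; _-_)

  ≈-refl : ∀ {f} → f ≈ f
  ≈-refl .coeff m = refl

  ≈-sym : ∀ {f g} → f ≈ g → g ≈ f
  ≈-sym f≈g .coeff m = sym (coeff f≈g m)

  ≈-trans : ∀ {f g h} → f ≈ g → g ≈ h → f ≈ h
  ≈-trans f≈g g≈h .coeff m = trans (coeff f≈g m) (coeff g≈h m)

  ≈-isEquivalence : IsEquivalence _≈_
  ≈-isEquivalence = record { refl = ≈-refl ; sym = ≈-sym ; trans = ≈-trans }

  negₚ : PS → PS
  negₚ f m = - f m

  +-cong : ∀ {f f′ g g′} → f ≈ f′ → g ≈ g′ → f +ₚ g ≈ f′ +ₚ g′
  +-cong f≈f′ g≈g′ .coeff m = cong₂ _+_ (coeff f≈f′ m) (coeff g≈g′ m)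

  *-cong : ∀ {f f′ g g′} → f ≈ f′ → g ≈ g′ → f *ₚ g ≈ f′ *ₚ g′
  *-cong f≈f′ g≈g′ .coeff m =
    sumℤ-cong (suc m) (λ i _ → cong₂ _*_ (coeff f≈f′ i) (coeff g≈g′ (m ∸ i)))

  -- One-sided congruences with the fixed factor explicit (a Cauchy product
  -- does not determine its factors, so they cannot be inferred).
  +-congˡ : ∀ f {g g′} → g ≈ g′ → f +ₚ g ≈ f +ₚ g′
  +-congˡ f = +-cong {f} ≈-refl

  +-congʳ : ∀ g {f f′} → f ≈ f′ → f +ₚ g ≈ f′ +ₚ g
  +-congʳ g f≈f′ = +-cong f≈f′ (≈-refl {g})

  *-congˡ : ∀ f {g g′} → g ≈ g′ → f *ₚ g ≈ f *ₚ g′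
  *-congˡ f = *-cong {f} ≈-refl

  *-congʳ : ∀ g {f f′} → f ≈ f′ → f *ₚ g ≈ f′ *ₚ g
  *-congʳ g f≈f′ = *-cong f≈f′ (≈-refl {g})

  *-comm : ∀ f g → f *ₚ g ≈ g *ₚ f
  *-comm f g .coeff m = trans (sumℤ-reverse (suc m) _) (sumℤ-cong (suc m) λ i i<1+m →
    trans (cong (λ x → f (m ∸ i) * g x) (ℕP.m∸[m∸n]≡n (ℕP.≤-pred i<1+m))) (ℤP.*-comm (f (m ∸ i)) (g i)))

  *-distribˡ : ∀ f g h → f *ₚ (g +ₚ h) ≈ (f *ₚ g) +ₚ (f *ₚ h)
  *-distribˡ f g h .coeff m =
    trans (sumℤ-cong (suc m) (λ i _ → ℤP.*-distribˡ-+ (f i) (g (m ∸ i)) (h (m ∸ i)))) (sumℤ-+ (suc m) _ _)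

  *-distribʳ : ∀ f g h → (g +ₚ h) *ₚ f ≈ (g *ₚ f) +ₚ (h *ₚ f)
  *-distribʳ f g h = ≈-trans (*-comm (g +ₚ h) f)
    (≈-trans (*-distribˡ f g h) (+-cong (*-comm f g) (*-comm f h)))

  *-assoc : ∀ f g h → (f *ₚ g) *ₚ h ≈ f *ₚ (g *ₚ h)
  *-assoc f g h .coeff m = begin
      sumℤ (suc m) (λ i → sumℤ (suc i) (λ a → f a * g (i ∸ a)) * h (m ∸ i))
    ≡⟨ sumℤ-cong (suc m) (λ i _ → sumℤ-*ʳ (suc i) (h (m ∸ i)) _) ⟩
      sumℤ (suc m) (λ i → sumℤ (suc i) (λ a → f a * g (i ∸ a) * h (m ∸ i)))
    ≡⟨ sumℤ-triangle m (λ a i → f a * g (i ∸ a) * h (m ∸ i)) ⟩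
      sumℤ (suc m) (λ a → sumℤ (suc (m ∸ a)) (λ b → f a * g (a ℕ.+ b ∸ a) * h (m ∸ (a ℕ.+ b))))
    ≡⟨ sumℤ-cong (suc m) (λ a _ → sumℤ-cong (suc (m ∸ a)) (λ b _ →
         trans (cong₂ (λ x y → f a * g x * h y) (ℕP.m+n∸m≡n a b) (sym (ℕP.∸-+-assoc m a b)))
               (ℤP.*-assoc (f a) (g b) (h (m ∸ a ∸ b))))) ⟩
      sumℤ (suc m) (λ a → sumℤ (suc (m ∸ a)) (λ b → f a * (g b * h (m ∸ a ∸ b))))
    ≡⟨ sumℤ-cong (suc m) (λ a _ → sym (sumℤ-*ˡ (suc (m ∸ a)) (f a) _)) ⟩
      sumℤ (suc m) (λ a → f a * sumℤ (suc (m ∸ a)) (λ b → g b * h (m ∸ a ∸ b)))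
    ∎
    where open ≡-Reasoning

  qpow-self : ∀ a → qpow a a ≡ + 1
  qpow-self a with a ℕ.≟ a
  ... | yes _ = refl
  ... | no a≢a = ⊥-elim (a≢a refl)

  qpow-other : ∀ a i → i ≢ a → qpow a i ≡ + 0
  qpow-other a i i≢a with i ℕ.≟ a
  ... | yes i≡a = ⊥-elim (i≢a i≡a)
  ... | no _ = refl

  qpow-shift : ∀ a f {m} → a ≤ m → (qpow a *ₚ f) m ≡ f (m ∸ a)
  qpow-shift a f {m} a≤m = begin
      sumℤ (suc m) (λ i → qpow a i * f (m ∸ i))
    ≡⟨ sumℤ-single (suc m) a _ (s≤s a≤m) (λ i _ i≢a → cong (_* f (m ∸ i)) (qpow-other a i i≢a)) ⟩
      qpow a a * f (m ∸ a)
    ≡⟨ cong (_* f (m ∸ a)) (qpow-self a) ⟩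
      + 1 * f (m ∸ a)
    ≡⟨ ℤP.*-identityˡ (f (m ∸ a)) ⟩
      f (m ∸ a)
    ∎
    where open ≡-Reasoning

  qpow-shift-low : ∀ a f {m} → m < a → (qpow a *ₚ f) m ≡ + 0
  qpow-shift-low a f {m} m<a = sumℤ-zero (suc m) _ (λ i i<1+m →
    trans (cong (_* f (m ∸ i)) (qpow-other a i (λ { refl → ℕP.<-irrefl refl (ℕP.<-≤-trans m<a (ℕP.≤-pred i<1+m)) })))
          (ℤP.*-zeroˡ (f (m ∸ i))))

  *-identityˡ : ∀ f → oneₚ *ₚ f ≈ f
  *-identityˡ f .coeff m = qpow-shift 0 f z≤n

  *-identityʳ : ∀ f → f *ₚ oneₚ ≈ f
  *-identityʳ f = ≈-trans (*-comm f oneₚ) (*-identityˡ f)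

  qpow-resp : ∀ {a b i j} → (i ≡ a → j ≡ b) → (j ≡ b → i ≡ a) → qpow a i ≡ qpow b j
  qpow-resp {a} {b} {i} {j} to from with i ℕ.≟ a | j ℕ.≟ b
  ... | yes _   | yes _   = refl
  ... | no  _   | no  _   = refl
  ... | yes i≡a | no  j≢b = ⊥-elim (j≢b (to i≡a))
  ... | no  i≢a | yes j≡b = ⊥-elim (i≢a (from j≡b))

  qpow-+ : ∀ a b → qpow a *ₚ qpow b ≈ qpow (a ℕ.+ b)
  qpow-+ a b .coeff m with a ℕ.≤? m
  ... | no a≰m = trans (qpow-shift-low a (qpow b) (ℕP.≰⇒> a≰m))
    (sym (qpow-other (a ℕ.+ b) m (λ m≡a+b → a≰m (subst (a ≤_) (sym m≡a+b) (ℕP.m≤m+n a b)))))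
  ... | yes a≤m = trans (qpow-shift a (qpow b) a≤m) (qpow-resp
    (λ m∸a≡b → trans (sym (ℕP.m+[n∸m]≡n a≤m)) (cong (a ℕ.+_) m∸a≡b))
    (λ m≡a+b → trans (cong (_∸ a) m≡a+b) (ℕP.m+n∸m≡n a b)))

  isCommutativeRing : IsCommutativeRing _≈_ _+ₚ_ _*ₚ_ negₚ zeroₚ oneₚ
  isCommutativeRing = record
    { isRing = record
      { +-isAbelianGroup = record
        { isGroup = record
          { isMonoid = record
            { isSemigroup = record
              { isMagma = record { isEquivalence = ≈-isEquivalence ; ∙-cong = +-cong }
              ; assoc   = λ f g h → mk≈ λ m → ℤP.+-assoc (f m) (g m) (h m) }
            ; identity  = (λ f → mk≈ λ m → ℤP.+-identityˡ (f m)) , (λ f → mk≈ λ m → ℤP.+-identityʳ (f m)) }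
          ; inverse = (λ f → mk≈ λ m → ℤP.+-inverseˡ (f m)) , (λ f → mk≈ λ m → ℤP.+-inverseʳ (f m))
          ; ⁻¹-cong = λ f≈g → mk≈ λ m → cong -_ (coeff f≈g m) }
        ; comm = λ f g → mk≈ λ m → ℤP.+-comm (f m) (g m) }
      ; *-cong     = *-cong
      ; *-assoc    = *-assoc
      ; *-identity = *-identityˡ , *-identityʳ
      ; distrib    = *-distribˡ , *-distribʳ }
    ; *-comm = *-comm }

  ring : CommutativeRing _ _
  ring = record { isCommutativeRing = isCommutativeRing }

  module ≈-Reasoning = SetoidReasoning (CommutativeRing.setoid ring)
  open CommSemigroupProperties (CommutativeRing.*-commutativeSemigroup ring) public
    using (interchange; x∙yz≈y∙xz)
  open RingProperties (CommutativeRing.ring ring) public using (-‿distribʳ-*)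

  ^-congˡ : ∀ n {f g} → f ≈ g → f ^ₚ n ≈ g ^ₚ n
  ^-congˡ zero    f≈g = ≈-refl
  ^-congˡ (suc n) f≈g = *-cong f≈g (^-congˡ n f≈g)

  ^-congʳ : ∀ f {a b} → a ≡ b → f ^ₚ a ≈ f ^ₚ b
  ^-congʳ f refl = ≈-refl

  ^-homo : ∀ f a b → f ^ₚ (a ℕ.+ b) ≈ (f ^ₚ a) *ₚ (f ^ₚ b)
  ^-homo f zero    b = ≈-sym (*-identityˡ (f ^ₚ b))
  ^-homo f (suc a) b = ≈-trans (*-congˡ f (^-homo f a b)) (≈-sym (*-assoc f (f ^ₚ a) (f ^ₚ b)))

  ^-distrib : ∀ f g n → (f *ₚ g) ^ₚ n ≈ (f ^ₚ n) *ₚ (g ^ₚ n)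
  ^-distrib f g zero    = ≈-sym (*-identityˡ oneₚ)
  ^-distrib f g (suc n) =
    ≈-trans (*-congˡ (f *ₚ g) (^-distrib f g n)) (interchange f g (f ^ₚ n) (g ^ₚ n))

  one-^ : ∀ n → oneₚ ^ₚ n ≈ oneₚ
  one-^ zero    = ≈-refl
  one-^ (suc n) = ≈-trans (*-identityˡ (oneₚ ^ₚ n)) (one-^ n)

  ·-cong : ∀ c {f g} → f ≈ g → c ·ₚ f ≈ c ·ₚ g
  ·-cong c f≈g .coeff m = cong (c *_) (coeff f≈g m)

  ·-distrib-+ : ∀ a b f → (+ (a ℕ.+ b)) ·ₚ f ≈ ((+ a) ·ₚ f) +ₚ ((+ b) ·ₚ f)
  ·-distrib-+ a b f .coeff m = trans (cong (_* f m) (ℤP.pos-+ a b)) (ℤP.*-distribʳ-+ (f m) (+ a) (+ b))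

  ·-*ˡ : ∀ c f g → (c ·ₚ f) *ₚ g ≈ c ·ₚ (f *ₚ g)
  ·-*ˡ c f g .coeff m =
    trans (sumℤ-cong (suc m) (λ i _ → ℤP.*-assoc c (f i) (g (m ∸ i)))) (sym (sumℤ-*ˡ (suc m) c _))

  ·-*ʳ : ∀ c f g → f *ₚ (c ·ₚ g) ≈ c ·ₚ (f *ₚ g)
  ·-*ʳ c f g = ≈-trans (*-comm f (c ·ₚ g)) (≈-trans (·-*ˡ c g f) (·-cong c (*-comm g f)))

  sumₚ-cong : ∀ j {F G : ℕ → PS} → (∀ i → i ≤ j → F i ≈ G i) → sumₚ j F ≈ sumₚ j G
  sumₚ-cong j F≈G .coeff m = sumℤ-cong (suc j) (λ i i<1+j → coeff (F≈G i (ℕP.≤-pred i<1+j)) m)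

  sumₚ-head : ∀ j (F : ℕ → PS) → sumₚ (suc j) F ≈ F 0 +ₚ sumₚ j (F ∘ suc)
  sumₚ-head j F .coeff m = sumℤ-head (suc j) (λ i → F i m)

  sumₚ-+ : ∀ j (F G : ℕ → PS) → sumₚ j (λ i → F i +ₚ G i) ≈ sumₚ j F +ₚ sumₚ j G
  sumₚ-+ j F G .coeff m = sumℤ-+ (suc j) (λ i → F i m) (λ i → G i m)

  *-sumₚ : ∀ f j (F : ℕ → PS) → f *ₚ sumₚ j F ≈ sumₚ j (λ i → f *ₚ F i)
  *-sumₚ f j F .coeff m = trans (sumℤ-cong (suc m) (λ i _ → sumℤ-*ˡ (suc j) (f i) _))
    (sumℤ-swap (suc m) (suc j) (λ i l → f i * F l (m ∸ i)))

open PowerSeriesRing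

module InfiniteProducts where
  open import Data.Integer using (_+_; _*_)

  _≈[_]_ : PS → ℕ → PS → Set
  f ≈[ N ] g = ∀ m → m ≤ N → f m ≡ g m

  *-cong-≤ : ∀ {f f′ g g′} N → f ≈[ N ] f′ → g ≈[ N ] g′ → (f *ₚ g) ≈[ N ] (f′ *ₚ g′)
  *-cong-≤ N f≈f′ g≈g′ m m≤N = sumℤ-cong (suc m) (λ i i<1+m →
    cong₂ _*_ (f≈f′ i (ℕP.≤-trans (ℕP.≤-pred i<1+m) m≤N)) (g≈g′ (m ∸ i) (ℕP.≤-trans (ℕP.m∸n≤m m i) m≤N)))

  ^-cong-≤ : ∀ {f g} N n → f ≈[ N ] g → (f ^ₚ n) ≈[ N ] (g ^ₚ n)
  ^-cong-≤ N zero    f≈g m _ = refl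
  ^-cong-≤ N (suc n) f≈g     = *-cong-≤ N f≈g (^-cong-≤ N n f≈g)

  -- The factors of an infinite product ∏_{n ≥ 1} F n are admissible when
  -- F n ≡ 1 (mod q^n); this is the convergence condition behind infProd.
  Admissible : (ℕ → PS) → Set
  Admissible F = ∀ n → F (suc n) ≈[ n ] oneₚ

  infProd-approx : ∀ {F} → Admissible F → ∀ N → infProd F ≈[ N ] finProd F N
  infProd-approx {F} admissible N m m≤N =
    trans (sym (stable (N ∸ m))) (cong (λ x → finProd F x m) (ℕP.m∸n+n≡m m≤N))
    where
    step : ∀ M → m ≤ M → finProd F (suc M) m ≡ finProd F M m
    step M m≤M = trans (*-cong-≤ {finProd F M} M (λ _ _ → refl) (admissible M) m m≤M)
                       (coeff (*-identityʳ (finProd F M)) m)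
    stable : ∀ d → finProd F (d ℕ.+ m) m ≡ finProd F m m
    stable zero    = refl
    stable (suc d) = trans (step (d ℕ.+ m) (ℕP.m≤n+m m d)) (stable d)

  finProd-cong : ∀ {F G : ℕ → PS} → (∀ n → F (suc n) ≈ G (suc n)) → ∀ N → finProd F N ≈ finProd G N
  finProd-cong F≈G zero    = ≈-refl
  finProd-cong F≈G (suc N) = *-cong (finProd-cong F≈G N) (F≈G N)

  finProd-* : ∀ (F G : ℕ → PS) N → finProd (λ n → F n *ₚ G n) N ≈ finProd F N *ₚ finProd G N
  finProd-* F G zero    = ≈-sym (*-identityˡ oneₚ)
  finProd-* F G (suc N) = ≈-trans (*-congʳ (F (suc N) *ₚ G (suc N)) (finProd-* F G N))
    (interchange (finProd F N) (finProd G N) (F (suc N)) (G (suc N)))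

  finProd-^ : ∀ (F : ℕ → PS) j N → finProd (λ n → F n ^ₚ j) N ≈ finProd F N ^ₚ j
  finProd-^ F j zero    = ≈-sym (one-^ j)
  finProd-^ F j (suc N) = ≈-trans (*-congʳ (F (suc N) ^ₚ j) (finProd-^ F j N))
    (≈-sym (^-distrib (finProd F N) (F (suc N)) j))

  infProd-split : ∀ {F A B : ℕ → PS} j → Admissible A → Admissible B →
    (∀ n → F (suc n) ≈ (A (suc n) ^ₚ j) *ₚ B (suc n)) →
    ∀ N → infProd F N ≡ ((infProd A ^ₚ j) *ₚ infProd B) N
  infProd-split {F} {A} {B} j admA admB F≈A^jB N =
    trans (coeff partial N)
      (sym (*-cong-≤ N (^-cong-≤ {infProd A} N j (infProd-approx admA N)) (infProd-approx admB N) N ℕP.≤-refl))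
    where
    partial : finProd F N ≈ (finProd A N ^ₚ j) *ₚ finProd B N
    partial = ≈-trans (finProd-cong F≈A^jB N)
      (≈-trans (finProd-* (λ n → A n ^ₚ j) B N) (*-congʳ (finProd B N) (finProd-^ A j N)))

open InfiniteProducts

module GeometricSeries where
  open import Data.Integer using (_+_; _-_)

  invOneMinusQ-periodic : ∀ n m → n ≤ m → invOneMinusQ n m ≡ invOneMinusQ n (m ∸ n)
  invOneMinusQ-periodic n m n≤m with n ∣? m | n ∣? (m ∸ n)
  ... | yes _   | yes _   = refl
  ... | no  _   | no  _   = refl
  ... | yes n∣m | no  n∤m∸n =
    ⊥-elim (n∤m∸n (∣m+n∣m⇒∣n (subst (n ∣_) (sym (ℕP.m+[n∸m]≡n n≤m)) n∣m) ∣-refl))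
  ... | no  n∤m | yes n∣m∸n = ⊥-elim (n∤m (∣m∸n∣n⇒∣m n n≤m n∣m∸n ∣-refl))

  invOneMinusQ-admissible : Admissible invOneMinusQ
  invOneMinusQ-admissible n zero _ with suc n ∣? 0
  ... | yes _   = refl
  ... | no  n∤0 = ⊥-elim (n∤0 (suc n ∣0))
  invOneMinusQ-admissible n (suc m) m<1+n with suc n ∣? suc m
  ... | yes 1+n∣1+m = ⊥-elim (ℕP.<-irrefl refl (ℕP.≤-trans (s≤s m<1+n) (∣⇒≤ 1+n∣1+m)))
  ... | no  _       = refl

  invOneMinusQ-inverse : ∀ n → invOneMinusQ (suc n) *ₚ (oneₚ -ₚ qpow (suc n)) ≈ oneₚ
  invOneMinusQ-inverse n .coeff m = begin
      (I *ₚ (oneₚ +ₚ negₚ (qpow (suc n)))) m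
    ≡⟨ coeff (*-distribˡ I oneₚ (negₚ (qpow (suc n)))) m ⟩
      (I *ₚ oneₚ) m + (I *ₚ negₚ (qpow (suc n))) m
    ≡⟨ cong₂ _+_ (coeff (*-identityʳ I) m) (sym (coeff (-‿distribʳ-* I (qpow (suc n))) m)) ⟩
      I m - (I *ₚ qpow (suc n)) m
    ≡⟨ cong (I m -_) (coeff (*-comm I (qpow (suc n))) m) ⟩
      I m - (qpow (suc n) *ₚ I) m
    ≡⟨ telescope (suc n ℕ.≤? m) ⟩
      oneₚ m
    ∎
    where
    open ≡-Reasoning
    I : PS
    I = invOneMinusQ (suc n)
    telescope : Dec (suc n ≤ m) → I m - (qpow (suc n) *ₚ I) m ≡ oneₚ m
    telescope (yes 1+n≤m) = begin
        I m - (qpow (suc n) *ₚ I) m      ≡⟨ cong₂ _-_ (invOneMinusQ-periodic (suc n) m 1+n≤m) (qpow-shift (suc n) I 1+n≤m) ⟩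
        I (m ∸ suc n) - I (m ∸ suc n)    ≡⟨ ℤP.+-inverseʳ (I (m ∸ suc n)) ⟩
        + 0                              ≡⟨ sym (qpow-other 0 m (λ { refl → ℕP.<-irrefl refl (ℕP.<-≤-trans (s≤s z≤n) 1+n≤m) })) ⟩
        oneₚ m                           ∎
    telescope (no 1+n≰m) = begin
        I m - (qpow (suc n) *ₚ I) m      ≡⟨ cong (I m -_) (qpow-shift-low (suc n) I (ℕP.≰⇒> 1+n≰m)) ⟩
        I m - + 0                        ≡⟨ ℤP.+-identityʳ (I m) ⟩
        I m                              ≡⟨ invOneMinusQ-admissible n m (ℕP.≤-pred (ℕP.≰⇒> 1+n≰m)) ⟩
        oneₚ m                           ∎

open GeometricSeries

module BinomialFactors where
  open import Data.Integer using (_+_; _-_)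

  pascal-sumₚ : ∀ K j (T : ℕ → PS) →
    sumₚ (suc j) (λ i → (+ (suc K C i)) ·ₚ T i) ≈
    sumₚ (suc j) (λ i → (+ (K C i)) ·ₚ T i) +ₚ sumₚ j (λ i → (+ (K C i)) ·ₚ T (suc i))
  pascal-sumₚ K j T = begin
      sumₚ (suc j) (λ i → (+ (suc K C i)) ·ₚ T i)
    ≈⟨ sumₚ-head j _ ⟩
      first +ₚ sumₚ j (λ i → (+ (suc K C suc i)) ·ₚ T (suc i))
    ≈⟨ +-congˡ first (sumₚ-cong j (λ i _ → pascal i)) ⟩
      first +ₚ sumₚ j (λ i → A i +ₚ B i)
    ≈⟨ +-congˡ first (sumₚ-+ j A B) ⟩
      first +ₚ (sumₚ j A +ₚ sumₚ j B)
    ≈⟨ mk≈ (λ m → sym (ℤP.+-assoc (first m) (sumₚ j A m) (sumₚ j B m))) ⟩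
      (first +ₚ sumₚ j A) +ₚ sumₚ j B
    ≈⟨ +-congʳ (sumₚ j B) (≈-sym (sumₚ-head j (λ i → (+ (K C i)) ·ₚ T i))) ⟩
      sumₚ (suc j) (λ i → (+ (K C i)) ·ₚ T i) +ₚ sumₚ j B
    ∎
    where
    open ≈-Reasoning
    -- C(n,0) reduces to 1, so both sums share this first term.
    first : PS
    first = (+ 1) ·ₚ T 0
    A B : ℕ → PS
    A i = (+ (K C suc i)) ·ₚ T (suc i)
    B i = (+ (K C i)) ·ₚ T (suc i)
    pascal : ∀ i → (+ (suc K C suc i)) ·ₚ T (suc i) ≈ A i +ₚ B i
    pascal i = ≈-trans (mk≈ λ m → cong (λ c → + c ℤ.* T (suc i) m) (sym (nCk+nC[k+1]≡[n+1]C[k+1] K i)))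
      (≈-trans (·-distrib-+ (K C i) (K C suc i) (T (suc i))) (mk≈ λ m → ℤP.+-comm (B i m) (A i m)))

  -- The i-th term q^{is}/(1-q^s)^i of factor1, and the ratio y = q^s/(1-q^s)
  -- between consecutive terms (the generating function of one nonempty run
  -- of equal parts of size s).
  term₁ : ℕ → ℕ → PS
  term₁ s i = qpow (i ℕ.* s) *ₚ (invOneMinusQ s ^ₚ i)

  runSeries : ℕ → PS
  runSeries s = qpow s *ₚ invOneMinusQ s

  term₁-suc : ∀ s i → term₁ s (suc i) ≈ runSeries s *ₚ term₁ s i
  term₁-suc s i = ≈-trans (*-congʳ (invOneMinusQ s ^ₚ suc i) (≈-sym (qpow-+ s (i ℕ.* s))))
    (interchange (qpow s) (qpow (i ℕ.* s)) (invOneMinusQ s) (invOneMinusQ s ^ₚ i))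

  factor1-no-colours : ∀ j s → factor1 0 j s ≈ oneₚ
  factor1-no-colours zero    s .coeff m =
    trans (ℤP.+-identityˡ _) (trans (ℤP.*-identityˡ _) (coeff (*-identityˡ oneₚ) m))
  factor1-no-colours (suc j) s .coeff m = begin
      sumₚ (suc j) (λ i → (+ (0 C i)) ·ₚ term₁ s i) m
    ≡⟨ coeff (sumₚ-head j (λ i → (+ (0 C i)) ·ₚ term₁ s i)) m ⟩
      + 1 ℤ.* (oneₚ *ₚ oneₚ) m + sumℤ (suc j) (λ i → + 0 ℤ.* term₁ s (suc i) m)
    ≡⟨ cong₂ _+_ (trans (ℤP.*-identityˡ _) (coeff (*-identityˡ oneₚ) m)) (sumℤ-zero (suc j) _ (λ _ _ → refl)) ⟩
      oneₚ m + + 0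
    ≡⟨ ℤP.+-identityʳ (oneₚ m) ⟩
      oneₚ m
    ∎
    where open ≡-Reasoning

  factor1-recurrence : ∀ c j s →
    factor1 (suc c) (suc j) s ≈ factor1 c (suc j) s +ₚ (runSeries s *ₚ factor1 c j s)
  factor1-recurrence c j s = ≈-trans (pascal-sumₚ c j (term₁ s))
    (+-congˡ (factor1 c (suc j) s) (≈-trans
      (sumₚ-cong j (λ i _ → ≈-trans (·-cong (+ (c C i)) (term₁-suc s i))
                                    (≈-sym (·-*ʳ (+ (c C i)) (runSeries s) (term₁ s i)))))
      (≈-sym (*-sumₚ (runSeries s) j (λ i → (+ (c C i)) ·ₚ term₁ s i)))))

  -- Clearing denominators: factor1 = (1-q^n)^{-j} · factor2, termwise
  -- (1-q^n)^{-j} (1-q^n)^{j-i} q^{in} = q^{in} (1-q^n)^{-i} for i ≤ j.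
  factor1≈factor2 : ∀ k j n →
    factor1 k j (suc n) ≈ (invOneMinusQ (suc n) ^ₚ j) *ₚ factor2 k j (suc n)
  factor1≈factor2 k j n = ≈-sym (≈-trans (*-sumₚ (I ^ₚ j) j (λ i → (+ (k C i)) ·ₚ term₂ i))
    (sumₚ-cong j (λ i i≤j → ≈-trans (·-*ʳ (+ (k C i)) (I ^ₚ j) (term₂ i)) (·-cong (+ (k C i)) (cancel i i≤j)))))
    where
    I Om : PS
    I  = invOneMinusQ (suc n)
    Om = oneₚ -ₚ qpow (suc n)
    term₂ : ℕ → PS
    term₂ i = (Om ^ₚ (j ∸ i)) *ₚ qpow (i ℕ.* suc n)
    cancel : ∀ i → i ≤ j → (I ^ₚ j) *ₚ ((Om ^ₚ (j ∸ i)) *ₚ qpow (i ℕ.* suc n)) ≈ term₁ (suc n) i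
    cancel i i≤j = begin
        (I ^ₚ j) *ₚ ((Om ^ₚ (j ∸ i)) *ₚ X)
      ≈⟨ *-congʳ ((Om ^ₚ (j ∸ i)) *ₚ X) (≈-trans (^-congʳ I (sym (ℕP.m+[n∸m]≡n i≤j))) (^-homo I i (j ∸ i))) ⟩
        ((I ^ₚ i) *ₚ (I ^ₚ (j ∸ i))) *ₚ ((Om ^ₚ (j ∸ i)) *ₚ X)
      ≈⟨ *-assoc (I ^ₚ i) (I ^ₚ (j ∸ i)) ((Om ^ₚ (j ∸ i)) *ₚ X) ⟩
        (I ^ₚ i) *ₚ ((I ^ₚ (j ∸ i)) *ₚ ((Om ^ₚ (j ∸ i)) *ₚ X))
      ≈⟨ *-congˡ (I ^ₚ i) (≈-sym (*-assoc (I ^ₚ (j ∸ i)) (Om ^ₚ (j ∸ i)) X)) ⟩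
        (I ^ₚ i) *ₚ (((I ^ₚ (j ∸ i)) *ₚ (Om ^ₚ (j ∸ i))) *ₚ X)
      ≈⟨ *-congˡ (I ^ₚ i) (*-congʳ X powers-cancel) ⟩
        (I ^ₚ i) *ₚ (oneₚ *ₚ X)
      ≈⟨ *-congˡ (I ^ₚ i) (*-identityˡ X) ⟩
        (I ^ₚ i) *ₚ X
      ≈⟨ *-comm (I ^ₚ i) X ⟩
        X *ₚ (I ^ₚ i)
      ∎
      where
      open ≈-Reasoning
      X = qpow (i ℕ.* suc n)
      powers-cancel : (I ^ₚ (j ∸ i)) *ₚ (Om ^ₚ (j ∸ i)) ≈ oneₚ
      powers-cancel = ≈-trans (≈-sym (^-distrib I Om (j ∸ i)))
        (≈-trans (^-congˡ (j ∸ i) (invOneMinusQ-inverse n)) (one-^ (j ∸ i)))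

  binomialFactor : ℕ → ℕ → ℕ → PS
  binomialFactor d j s = sumₚ j (λ i → (+ (((d ℕ.+ i) ∸ 1) C i)) ·ₚ qpow (i ℕ.* s))

  -- Pascal recurrence for factor2 in both k and j: writing x = q^s,
  --   P_{K+1,j+1} = P_{K,j} + C(K, j+1) x^{j+1},
  -- because after Pascal's rule the two halves recombine as (1-x)·P + x·P.
  factor2-recurrence : ∀ K j s →
    factor2 (suc K) (suc j) s ≈ factor2 K j s +ₚ ((+ (K C suc j)) ·ₚ qpow (suc j ℕ.* s))
  factor2-recurrence K j s = begin
      factor2 (suc K) (suc j) s
    ≈⟨ pascal-sumₚ K j T ⟩
      (sumₚ j (λ i → (+ (K C i)) ·ₚ T i) +ₚ top) +ₚ sumₚ j (λ i → (+ (K C i)) ·ₚ T (suc i))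
    ≈⟨ +-cong (+-congʳ top lower-terms) upper-terms ⟩
      ((Om *ₚ P) +ₚ top) +ₚ (x *ₚ P)
    ≈⟨ mk≈ (λ m → swap ((Om *ₚ P) m) (top m) ((x *ₚ P) m)) ⟩
      ((Om *ₚ P) +ₚ (x *ₚ P)) +ₚ top
    ≈⟨ +-congʳ top (≈-sym (*-distribʳ P Om x)) ⟩
      ((Om +ₚ x) *ₚ P) +ₚ top
    ≈⟨ +-cong (≈-trans (*-congʳ P Om+x≈1) (*-identityˡ P)) top-term ⟩
      P +ₚ ((+ (K C suc j)) ·ₚ X (suc j))
    ∎
    where
    open ≈-Reasoning
    x Om P : PS
    x = qpow s
    Om = oneₚ -ₚ x
    P = factor2 K j s
    X : ℕ → PS
    X i = qpow (i ℕ.* s)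
    T : ℕ → PS
    T i = (Om ^ₚ (suc j ∸ i)) *ₚ X i
    top : PS
    top = (+ (K C suc j)) ·ₚ T (suc j)
    top-term : top ≈ (+ (K C suc j)) ·ₚ X (suc j)
    top-term = ·-cong (+ (K C suc j)) (≈-trans (*-congʳ (X (suc j)) (^-congʳ Om (ℕP.n∸n≡0 j)))
                                               (*-identityˡ (X (suc j))))
    swap : ∀ a b c → (a + b) + c ≡ (a + c) + b
    swap = solve-∀
    Om+x≈1 : (Om +ₚ x) ≈ oneₚ
    Om+x≈1 .coeff m = cancel (oneₚ m) (x m)
      where cancel : ∀ a b → (a - b) + b ≡ a
            cancel = solve-∀
    -- the terms i ≤ j, where the exponent j+1-i is positive
    lower-terms : sumₚ j (λ i → (+ (K C i)) ·ₚ T i) ≈ Om *ₚ P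
    lower-terms = ≈-trans
      (sumₚ-cong j (λ i i≤j → ≈-trans
        (·-cong (+ (K C i)) (≈-trans (*-congʳ (X i) (^-congʳ Om (ℕP.+-∸-assoc 1 i≤j)))
                                     (*-assoc Om (Om ^ₚ (j ∸ i)) (X i))))
        (≈-sym (·-*ʳ (+ (K C i)) Om ((Om ^ₚ (j ∸ i)) *ₚ X i)))))
      (≈-sym (*-sumₚ Om j (λ i → (+ (K C i)) ·ₚ ((Om ^ₚ (j ∸ i)) *ₚ X i))))
    -- the shifted half: T (i+1) = x · (1-x)^{j-i} x^i
    upper-terms : sumₚ j (λ i → (+ (K C i)) ·ₚ T (suc i)) ≈ x *ₚ P
    upper-terms = ≈-trans
      (sumₚ-cong j (λ i _ → ≈-trans
        (·-cong (+ (K C i)) (≈-trans (*-congˡ (Om ^ₚ (j ∸ i)) (≈-sym (qpow-+ s (i ℕ.* s))))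
                                     (x∙yz≈y∙xz (Om ^ₚ (j ∸ i)) x (X i))))
        (≈-sym (·-*ʳ (+ (K C i)) x ((Om ^ₚ (j ∸ i)) *ₚ X i)))))
      (≈-sym (*-sumₚ x j (λ i → (+ (K C i)) ·ₚ ((Om ^ₚ (j ∸ i)) *ₚ X i))))

  factor2≈binomialFactor : ∀ d j s → factor2 (d ℕ.+ j) j s ≈ binomialFactor d j s
  factor2≈binomialFactor d zero    s .coeff m = cong (λ c → + 0 + (+ 1 ℤ.* c)) (coeff (*-identityˡ (qpow 0)) m)
  factor2≈binomialFactor d (suc j) s = begin
      factor2 (d ℕ.+ suc j) (suc j) s
    ≡⟨ cong (λ K → factor2 K (suc j) s) (ℕP.+-suc d j) ⟩
      factor2 (suc (d ℕ.+ j)) (suc j) s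
    ≈⟨ factor2-recurrence (d ℕ.+ j) j s ⟩
      factor2 (d ℕ.+ j) j s +ₚ ((+ ((d ℕ.+ j) C suc j)) ·ₚ qpow (suc j ℕ.* s))
    ≈⟨ +-cong (factor2≈binomialFactor d j s)
         (mk≈ λ m → cong (λ n → + (n C suc j) ℤ.* qpow (suc j ℕ.* s) m) (cong (_∸ 1) (sym (ℕP.+-suc d j)))) ⟩
      binomialFactor d (suc j) s
    ∎
    where open ≈-Reasoning

  factor2≈factor3 : ∀ k j s → j ≤ k → factor2 k j s ≈ factor3 k j s
  factor2≈factor3 k j s j≤k =
    subst (λ K → factor2 K j s ≈ factor3 k j s) (ℕP.m∸n+n≡m j≤k) (factor2≈binomialFactor (k ∸ j) j s)

  factor3-admissible : ∀ k j → Admissible (factor3 k j)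
  factor3-admissible k j n m m≤n = begin
      sumℤ (suc j) (λ i → c i ℤ.* qpow (i ℕ.* suc n) m)
    ≡⟨ sumℤ-head j _ ⟩
      + 1 ℤ.* qpow 0 m + sumℤ j (λ i → c (suc i) ℤ.* qpow (suc i ℕ.* suc n) m)
    ≡⟨ cong₂ _+_ (ℤP.*-identityˡ (qpow 0 m)) (sumℤ-zero j _ (λ i _ → higher i)) ⟩
      qpow 0 m + + 0
    ≡⟨ ℤP.+-identityʳ (qpow 0 m) ⟩
      oneₚ m
    ∎
    where
    open ≡-Reasoning
    c : ℕ → ℤ
    c i = + ((((k ∸ j) ℕ.+ i) ∸ 1) C i)
    higher : ∀ i → c (suc i) ℤ.* qpow (suc i ℕ.* suc n) m ≡ + 0
    higher i = trans (cong (c (suc i) ℤ.*_) (qpow-other (suc i ℕ.* suc n) m (λ { refl →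
        ℕP.<-irrefl refl (ℕP.≤-trans (s≤s m≤n) (ℕP.m≤m+n (suc n) (i ℕ.* suc n))) })))
      (ℤP.*-zeroʳ (c (suc i)))

  factor2-admissible : ∀ k j → j ≤ k → Admissible (factor2 k j)
  factor2-admissible k j j≤k n m m≤n =
    trans (coeff (factor2≈factor3 k j (suc n) j≤k) m) (factor3-admissible k j n m m≤n)

  productForm₂ : ∀ k j → j ≤ k → ∀ N →
    infProd (factor1 k j) N ≡ ((invPoch ^ₚ j) *ₚ infProd (factor2 k j)) N
  productForm₂ k j j≤k = infProd-split j invOneMinusQ-admissible (factor2-admissible k j j≤k)
    (factor1≈factor2 k j)

  productForm₃ : ∀ k j → j ≤ k → ∀ N →
    infProd (factor1 k j) N ≡ ((invPoch ^ₚ j) *ₚ infProd (factor3 k j)) N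
  productForm₃ k j j≤k = infProd-split j invOneMinusQ-admissible (factor3-admissible k j)
    (λ n → ≈-trans (factor1≈factor2 k j n)
                   (*-congˡ (invOneMinusQ (suc n) ^ₚ j) (factor2≈factor3 k j (suc n) j≤k)))

open BinomialFactors


module ColouredPartitions (k j : ℕ) where

  size : Part k → ℕ
  size = proj₁

  _≟ₚ_ : (p q : Part k) → Dec (p ≡ q)
  _≟ₚ_ = ≡-dec ℕ._≟_ Fin._≟_

  ≽-refl : ∀ {p : Part k} → p ≽ p
  ≽-refl = inj₂ (refl , ℕP.≤-refl)

  ≽-trans : ∀ {p q r : Part k} → p ≽ q → q ≽ r → p ≽ r
  ≽-trans (inj₁ q<p)          (inj₁ r<q)          = inj₁ (ℕP.<-trans r<q q<p)
  ≽-trans (inj₁ q<p)          (inj₂ (refl , _))   = inj₁ q<p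
  ≽-trans (inj₂ (refl , _))   (inj₁ r<q)          = inj₁ r<q
  ≽-trans (inj₂ (refl , q≤p)) (inj₂ (refl , r≤q)) = inj₂ (refl , ℕP.≤-trans r≤q q≤p)

  ≽-antisym : ∀ {p q : Part k} → p ≽ q → q ≽ p → p ≡ q
  ≽-antisym (inj₁ q<p)        (inj₁ p<q)        = ⊥-elim (ℕP.<-asym q<p p<q)
  ≽-antisym (inj₁ q<p)        (inj₂ (refl , _)) = ⊥-elim (ℕP.<-irrefl refl q<p)
  ≽-antisym (inj₂ (refl , _)) (inj₁ p<q)        = ⊥-elim (ℕP.<-irrefl refl p<q)
  ≽-antisym {a , b} (inj₂ (refl , b′≤b)) (inj₂ (_ , b≤b′)) =
    cong (a ,_) (FinP.toℕ-injective (ℕP.≤-antisym b≤b′ b′≤b))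

  sorted-head : ∀ {p : Part k} {ps} → Linked _≽_ (p ∷ ps) → All (p ≽_) ps
  sorted-head [-]         = []
  sorted-head (p≽q ∷ qps) = Linked⇒All ≽-trans p≽q qps

  sorted-++ʳ : ∀ (ps : List (Part k)) {qs} → Linked _≽_ (ps ++ qs) → Linked _≽_ qs
  sorted-++ʳ []       sorted = sorted
  sorted-++ʳ (p ∷ ps) sorted = sorted-++ʳ ps (Linked.tail sorted)

  sorted-run : ∀ (p : Part k) r {qs} → Linked _≽_ qs → All (p ≽_) qs → Linked _≽_ (replicate r p ++ qs)
  sorted-run p zero                 sorted _           = sorted
  sorted-run p (suc zero) {[]}      _      _           = [-]
  sorted-run p (suc zero) {q ∷ qs}  sorted (p≽q ∷ _)   = p≽q ∷ sorted
  sorted-run p (suc (suc r))        sorted above       = ≽-refl ∷ sorted-run p (suc r) sorted above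

  HeadNot : Part k → List (Part k) → Set
  HeadNot p []      = ⊤
  HeadNot p (q ∷ _) = q ≢ p

  sorted-avoids : ∀ (p : Part k) {qs} → Linked _≽_ qs → All (p ≽_) qs → HeadNot p qs → All (_≢ p) qs
  sorted-avoids p {[]}     _      _          _     = []
  sorted-avoids p {q ∷ qs} sorted (p≽q ∷ _) q≢p =
    q≢p ∷ All.map (λ {r} q≽r r≡p → q≢p (≽-antisym (subst (q ≽_) r≡p q≽r) p≽q)) (sorted-head sorted)

  avoids-headNot : ∀ p {qs} → All (_≢ p) qs → HeadNot p qs
  avoids-headNot p []        = tt
  avoids-headNot p (q≢p ∷ _) = q≢p

  runLength : Part k → List (Part k) → ℕ
  runLength p []       = 0
  runLength p (q ∷ qs) with q ≟ₚ p
  ... | yes _ = suc (runLength p qs)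
  ... | no  _ = 0

  afterRun : Part k → List (Part k) → List (Part k)
  afterRun p []       = []
  afterRun p (q ∷ qs) with q ≟ₚ p
  ... | yes _ = afterRun p qs
  ... | no  _ = q ∷ qs

  run-decomposition : ∀ p qs → replicate (runLength p qs) p ++ afterRun p qs ≡ qs
  run-decomposition p []       = refl
  run-decomposition p (q ∷ qs) with q ≟ₚ p
  ... | yes refl = cong (q ∷_) (run-decomposition p qs)
  ... | no  _    = refl

  afterRun-headNot : ∀ p qs → HeadNot p (afterRun p qs)
  afterRun-headNot p []       = tt
  afterRun-headNot p (q ∷ qs) with q ≟ₚ p
  ... | yes _   = afterRun-headNot p qs
  ... | no  q≢p = q≢p

  runLength-run : ∀ p r qs → HeadNot p qs → runLength p (replicate r p ++ qs) ≡ r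
  runLength-run p (suc r) qs headNot with p ≟ₚ p
  ... | yes _   = cong suc (runLength-run p r qs headNot)
  ... | no  p≢p = ⊥-elim (p≢p refl)
  runLength-run p zero []       _   = refl
  runLength-run p zero (q ∷ qs) q≢p with q ≟ₚ p
  ... | yes q≡p = ⊥-elim (q≢p q≡p)
  ... | no  _   = refl

  afterRun-run : ∀ p r qs → HeadNot p qs → afterRun p (replicate r p ++ qs) ≡ qs
  afterRun-run p (suc r) qs headNot with p ≟ₚ p
  ... | yes _   = afterRun-run p r qs headNot
  ... | no  p≢p = ⊥-elim (p≢p refl)
  afterRun-run p zero []       _   = refl
  afterRun-run p zero (q ∷ qs) q≢p with q ≟ₚ p
  ... | yes q≡p = ⊥-elim (q≢p q≡p)
  ... | no  _   = refl

  sum-run : ∀ (p : Part k) r qs →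
    sum (map size (replicate r p ++ qs)) ≡ r ℕ.* size p ℕ.+ sum (map size qs)
  sum-run p zero    qs = refl
  sum-run p (suc r) qs =
    trans (cong (size p ℕ.+_) (sum-run p r qs)) (sym (ℕP.+-assoc (size p) (r ℕ.* size p) _))

  NoSize : ℕ → List (Part k) → Set
  NoSize a = All (λ q → size q ≢ a)

  colorsOfSize-++ : ∀ a (ps qs : List (Part k)) →
    colorsOfSize a (ps ++ qs) ≡ colorsOfSize a ps ++ colorsOfSize a qs
  colorsOfSize-++ a ps qs = trans (cong (map proj₂) (ListP.filter-++ (λ p → proj₁ p ℕ.≟ a) ps qs))
    (ListP.map-++ proj₂ (filter (λ p → proj₁ p ℕ.≟ a) ps) (filter (λ p → proj₁ p ℕ.≟ a) qs))

  colorsOfSize-none : ∀ a {ps : List (Part k)} → NoSize a ps → colorsOfSize a ps ≡ []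
  colorsOfSize-none a none = cong (map proj₂) (ListP.filter-none (λ p → proj₁ p ℕ.≟ a) none)

  colorsOfSize-run : ∀ (p : Part k) r → colorsOfSize (size p) (replicate r p) ≡ replicate r (proj₂ p)
  colorsOfSize-run p zero    = refl
  colorsOfSize-run p (suc r) =
    trans (cong (map proj₂) (ListP.filter-accept (λ q → proj₁ q ℕ.≟ size p) {p} {replicate r p} refl))
          (cong (proj₂ p ∷_) (colorsOfSize-run p r))

  numColors-none : ∀ a {ps : List (Part k)} → NoSize a ps → numColors a ps ≡ 0
  numColors-none a none = cong (length ∘ deduplicate Fin._≟_) (colorsOfSize-none a none)

  numColors-skip : ∀ a {ps : List (Part k)} qs → NoSize a ps → numColors a (ps ++ qs) ≡ numColors a qs
  numColors-skip a {ps} qs none = cong (length ∘ deduplicate Fin._≟_)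
    (trans (colorsOfSize-++ a ps qs) (cong (_++ colorsOfSize a qs) (colorsOfSize-none a none)))

  numColors-otherRun : ∀ a (p : Part k) r qs → size p ≢ a →
    numColors a (replicate r p ++ qs) ≡ numColors a qs
  numColors-otherRun a p r qs size≢a = numColors-skip a qs (AllP.replicate⁺ r size≢a)

  numColors-zero : ∀ a (ps : List (Part k)) → numColors a ps ≤ 0 → NoSize a ps
  numColors-zero a []       _  = []
  numColors-zero a (q ∷ ps) nc≤0 with size q ℕ.≟ a
  ... | yes size≡a = ⊥-elim (ℕP.<-irrefl refl (ℕP.≤-trans positive nc≤0))
    where positive : 1 ≤ numColors a (q ∷ ps)
          positive = subst (λ qs → 1 ≤ length (deduplicate Fin._≟_ (map proj₂ qs)))
            (sym (ListP.filter-accept (λ p → proj₁ p ℕ.≟ a) {q} {ps} size≡a)) (s≤s z≤n)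
  ... | no  size≢a = size≢a ∷ numColors-zero a ps
      (subst (_≤ 0) (cong (length ∘ deduplicate Fin._≟_ ∘ map proj₂)
                          (ListP.filter-reject (λ p → proj₁ p ℕ.≟ a) {q} {ps} size≢a)) nc≤0)

  dedup-run : ∀ c r (cs : List (Fin k)) → c ∉ cs →
    filter (¬? ∘ (c Fin.≟_)) (deduplicate Fin._≟_ (replicate r c ++ cs)) ≡ deduplicate Fin._≟_ cs
  dedup-run c zero    cs c∉cs = ListP.filter-all (¬? ∘ (c Fin.≟_))
    (All.tabulate (λ {d} d∈ c≡d → c∉cs (subst (_∈ cs) (sym c≡d) (Membership.∈-deduplicate⁻ Fin._≟_ cs d∈))))
  dedup-run c (suc r) cs c∉cs =
    trans (ListP.filter-reject (¬? ∘ (c Fin.≟_)) {c} (λ c≢c → c≢c refl))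
      (trans (ListP.filter-idem (¬? ∘ (c Fin.≟_)) (deduplicate Fin._≟_ (replicate r c ++ cs)))
             (dedup-run c r cs c∉cs))

  numColors-run : ∀ (p : Part k) r qs → All (_≢ p) qs →
    numColors (size p) (replicate (suc r) p ++ qs) ≡ suc (numColors (size p) qs)
  numColors-run p r qs avoids = trans
    (cong (length ∘ deduplicate Fin._≟_)
      (trans (colorsOfSize-++ (size p) (replicate (suc r) p) qs)
             (cong (_++ colorsOfSize (size p) qs) (colorsOfSize-run p (suc r)))))
    (cong (suc ∘ length) (dedup-run (proj₂ p) r (colorsOfSize (size p) qs) colour-new))
    where
    colour-new : proj₂ p ∉ colorsOfSize (size p) qs
    colour-new c∈ with Membership.∈-map⁻ proj₂ c∈
    ... | q , q∈ , c≡ with Membership.∈-filter⁻ (λ q → proj₁ q ℕ.≟ size p) q∈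
    ... | q∈qs , size≡ = All.lookup avoids q∈qs (cong₂ _,_ size≡ (sym c≡))

  -- A (k,j)-coloured partition of N is a stage with
  -- n = N, c = k, j′ = j; the stages are counted by recursion on (n, c, j′).

  record Stage (n c j′ t : ℕ) : Set where
    constructor stage
    field
      parts      : List (Part k)
      .positive  : All (λ p → 1 ≤ size p) parts
      .bounded   : All (λ p → size p ≤ n) parts
      .sorted    : Linked _≽_ parts
      .topColors : All (λ p → size p ≡ n → toℕ (proj₂ p) < c) parts
      .sizeSum   : sum (map size parts) ≡ t
      .lowBound  : ∀ a → a < n → numColors a parts ≤ j
      .topBound  : numColors n parts ≤ j′
  open Stage

  -- All proof fields are irrelevant.
  stage-≡ : ∀ {n c j′ t} {x y : Stage n c j′ t} → parts x ≡ parts y → x ≡ y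
  stage-≡ {x = stage ps _ _ _ _ _ _ _} {stage .ps _ _ _ _ _ _ _} refl = refl

  stage₀-empty : ∀ {c j′ t} (x : Stage 0 c j′ t) → parts x ≡ []
  stage₀-empty (stage []      _        _       _ _ _ _ _) = refl
  stage₀-empty (stage (p ∷ _) positive bounded _ _ _ _ _) =
    Irrelevant.⊥-elim (ℕP.<-irrefl refl (ℕP.≤-trans (All.head positive) (All.head bounded)))

  emptyStage : ∀ {c j′} → Stage 0 c j′ 0
  emptyStage = stage [] [] [] [] [] refl (λ _ _ → z≤n) z≤n

  noStage₀ : ∀ {c j′ t} → Stage 0 c j′ (suc t) → ⊥
  noStage₀ x with stage₀-empty x
  noStage₀ (stage [] _ _ _ _ () _ _) | refl

  -- Without colours for the top size, no part has the top size n+1.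
  noTopColours : ∀ {n j′ t} → Stage (suc n) 0 j′ t ↔ Stage n k j t
  noTopColours {n} {j′} {t} = mk↔ₛ′ to from (λ _ → refl) (λ _ → refl)
    where
    below : ∀ {p : Part k} → size p ≤ suc n → (size p ≡ suc n → toℕ (proj₂ p) < 0) → size p ≤ n
    below p≤1+n noColour with ℕP.m≤n⇒m<n∨m≡n p≤1+n
    ... | inj₁ p<1+n = ℕP.≤-pred p<1+n
    ... | inj₂ p≡1+n = ⊥-elim (ℕP.n≮0 (noColour p≡1+n))
    to : Stage (suc n) 0 j′ t → Stage n k j t
    to (stage ps pos bnd srt top sm low _) =
      stage ps pos (All.zipWith (λ (b , c) → below b c) (bnd , top)) srt
        (All.tabulate (λ {p} _ _ → FinP.toℕ<n (proj₂ p))) sm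
        (λ a a<n → low a (ℕP.m<n⇒m<1+n a<n)) (low n ℕP.≤-refl)
    from : Stage n k j t → Stage (suc n) 0 j′ t
    from (stage ps pos bnd srt _ sm low topN) =
      stage ps pos (All.map ℕP.m≤n⇒m≤1+n bnd) srt (All.map (λ {p} b e → ⊥-elim (noTop p b e)) bnd) sm
        (λ a a<1+n → belowTop {ps} {a} low topN (ℕP.m≤n⇒m<n∨m≡n (ℕP.≤-pred a<1+n)))
        (subst (_≤ j′) (sym (numColors-none (suc n) {ps} (All.map (λ {p} → noTop p) bnd))) z≤n)
      where
      noTop : ∀ (p : Part k) → size p ≤ n → size p ≢ suc n
      noTop _ b e = ℕP.<-irrefl e (s≤s b)
      belowTop : ∀ {ps : List (Part k)} {a} → (∀ a → a < n → numColors a ps ≤ j) →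
                 numColors n ps ≤ j → a < n ⊎ a ≡ n → numColors a ps ≤ j
      belowTop low _    (inj₁ a<n) = low _ a<n
      belowTop _   topN (inj₂ refl) = topN

  -- With budget 0 for the top size there are no top parts, whatever c is.
  noTopBudget : ∀ {n c t} → Stage (suc n) (suc c) 0 t ↔ Stage (suc n) c 0 t
  noTopBudget {n} {c} {t} = mk↔ₛ′ to from (λ _ → refl) (λ _ → refl)
    where
    to : Stage (suc n) (suc c) 0 t → Stage (suc n) c 0 t
    to (stage ps pos bnd srt _ sm low topN) =
      stage ps pos bnd srt (All.map (λ size≢ e → ⊥-elim (size≢ e)) (numColors-zero (suc n) ps topN)) sm low topN
    from : Stage (suc n) c 0 t → Stage (suc n) (suc c) 0 t
    from (stage ps pos bnd srt top sm low topN) =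
      stage ps pos bnd srt (All.map (λ col e → ℕP.m<n⇒m<1+n (col e)) top) sm low topN

  RunOf : ℕ → ℕ → Set
  RunOf s i = Σ ℕ (λ r → i ≡ suc r ℕ.* s)

  -- Allowing the colour c for the top size s = n+1: a stage either does not
  -- use the part p = s_c, or it starts with a nonempty run of p of total
  -- size i, after which c is forbidden and one colour less is allowed.
  module AddColour (n c : ℕ) (c<k : c < k) where
    s : ℕ
    s = suc n

    p : Part k
    p = (s , fromℕ< c<k)

    colour-p : toℕ (proj₂ p) ≡ c
    colour-p = FinP.toℕ-fromℕ< c<k

    Split : ℕ → ℕ → Set
    Split j′ t = Stage s c (suc j′) t ⊎ Σ (Fin (suc t)) (λ i → RunOf s (toℕ i) × Stage s c j′ (t ∸ toℕ i))

    below-p : ∀ {q : Part k} → size q ≤ s → (size q ≡ s → toℕ (proj₂ q) < suc c) → p ≽ q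
    below-p {q} q≤s colour with ℕP.m≤n⇒m<n∨m≡n q≤s
    ... | inj₁ q<s = inj₁ q<s
    ... | inj₂ q≡s = inj₂ (q≡s , subst (toℕ (proj₂ q) ≤_) (sym colour-p) (ℕP.≤-pred (colour q≡s)))

    other-colour : ∀ {q : Part k} → q ≢ p → (size q ≡ s → toℕ (proj₂ q) < suc c) → (size q ≡ s → toℕ (proj₂ q) < c)
    other-colour q≢p colour q≡s = ℕP.≤∧≢⇒< (ℕP.≤-pred (colour q≡s))
      (λ q≡c → q≢p (cong₂ _,_ q≡s (FinP.toℕ-injective (trans q≡c (sym colour-p)))))

    not-p : ∀ {q : Part k} → (size q ≡ s → toℕ (proj₂ q) < c) → q ≢ p
    not-p colour refl = ℕP.<-irrefl colour-p (colour refl)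

    widen : ∀ {q : Part k} → (size q ≡ s → toℕ (proj₂ q) < c) → (size q ≡ s → toℕ (proj₂ q) < suc c)
    widen colour q≡s = ℕP.m<n⇒m<1+n (colour q≡s)

    tail-avoids : ∀ r qs → HeadNot p qs → Linked _≽_ (replicate (suc r) p ++ qs) → All (_≢ p) qs
    tail-avoids r qs headNot sorted =
      sorted-avoids p (sorted-++ʳ (replicate (suc r) p) sorted) (AllP.++⁻ʳ (replicate r p) (sorted-head sorted)) headNot

    dropRun : ∀ {j′ t} (x : Stage s (suc c) (suc j′) t) r qs → HeadNot p qs →
      parts x ≡ replicate (suc r) p ++ qs → ∀ {t′} → .(t′ ≡ t ∸ suc r ℕ.* s) → Stage s c j′ t′
    dropRun (stage _ pos bnd srt top sm low topN) r qs headNot refl t′≡ =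
      stage qs (AllP.++⁻ʳ run pos) (AllP.++⁻ʳ run bnd) (sorted-++ʳ run srt)
        (All.zipWith (λ (q≢p , col) → other-colour q≢p col) (tail-avoids r qs headNot srt , AllP.++⁻ʳ run top))
        (trans (trans (sym (ℕP.m+n∸m≡n (suc r ℕ.* s) (sum (map size qs))))
                      (cong (_∸ suc r ℕ.* s) (trans (sym (sum-run p (suc r) qs)) sm))) (sym t′≡))
        (λ a a<s → subst (_≤ j) (numColors-otherRun a p (suc r) qs (λ s≡a → ℕP.<-irrefl (sym s≡a) a<s)) (low a a<s))
        (ℕP.≤-pred (subst (_≤ suc _) (numColors-run p r qs (tail-avoids r qs headNot srt)) topN))
      where run : List (Part k)
            run = replicate (suc r) p

    dropRun-parts : ∀ {j′ t} (x : Stage s (suc c) (suc j′) t) r qs (headNot : HeadNot p qs)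
      (x≡ : parts x ≡ replicate (suc r) p ++ qs) {t′} .(t′≡ : t′ ≡ t ∸ suc r ℕ.* s) →
      parts (dropRun x r qs headNot x≡ t′≡) ≡ qs
    dropRun-parts (stage _ _ _ _ _ _ _ _) r qs headNot refl t′≡ = refl

    run-fits : ∀ r qs {t} → sum (map size (replicate (suc r) p ++ qs)) ≡ t → suc r ℕ.* s < suc t
    run-fits r qs sum≡t = s≤s (subst (suc r ℕ.* s ≤_) (trans (sym (sum-run p (suc r) qs)) sum≡t) (ℕP.m≤m+n _ _))

    decompose : ∀ ps {r} → runLength p ps ≡ r → replicate r p ++ afterRun p ps ≡ ps
    decompose ps refl = run-decomposition p ps

    split : ∀ {j′ t} (x : Stage s (suc c) (suc j′) t) r → runLength p (parts x) ≡ r → Split j′ t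
    split (stage ps pos bnd srt top sm low topN) zero run≡0 =
      inj₁ (stage ps pos bnd srt
        (All.zipWith (λ (q≢p , col) → other-colour q≢p col)
          (sorted-avoids p srt (All.zipWith (λ (b , col) → below-p b col) (bnd , top))
                         (subst (HeadNot p) (decompose ps run≡0) (afterRun-headNot p ps)) , top))
        sm low topN)
    split {t = t} x@(stage ps _ _ _ _ sm _ _) (suc r) run≡ =
      inj₂ (fromℕ< (fits sm) , (r , FinP.toℕ-fromℕ< (fits sm)) ,
            dropRun x r (afterRun p ps) (afterRun-headNot p ps) (sym (decompose ps run≡))
                    (cong (t ∸_) (FinP.toℕ-fromℕ< (fits sm))))
      where fits : sum (map size ps) ≡ t → suc r ℕ.* s < suc t
            fits sum≡t = run-fits r (afterRun p ps) (trans (cong (sum ∘ map size) (decompose ps run≡)) sum≡t)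

    merge : ∀ {j′ t} → Split j′ t → Stage s (suc c) (suc j′) t
    merge (inj₁ (stage ps pos bnd srt top sm low topN)) = stage ps pos bnd srt (All.map widen top) sm low topN
    merge (inj₂ (i , (r , i≡) , stage qs pos bnd srt top sm low topN)) =
      stage (replicate (suc r) p ++ qs)
        (AllP.++⁺ (AllP.replicate⁺ (suc r) (s≤s z≤n)) pos)
        (AllP.++⁺ (AllP.replicate⁺ (suc r) ℕP.≤-refl) bnd)
        (sorted-run p (suc r) srt (All.zipWith (λ (b , col) → below-p b (widen col)) (bnd , top)))
        (AllP.++⁺ (AllP.replicate⁺ (suc r) (λ _ → subst (_< suc c) (sym colour-p) ℕP.≤-refl)) (All.map widen top))
        (trans (sum-run p (suc r) qs) (trans (cong₂ ℕ._+_ (sym i≡) sm) (ℕP.m+[n∸m]≡n (ℕP.≤-pred (FinP.toℕ<n i)))))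
        (λ a a<s → subst (_≤ j) (sym (numColors-otherRun a p (suc r) qs (λ s≡a → ℕP.<-irrefl (sym s≡a) a<s))) (low a a<s))
        (subst (_≤ suc _) (sym (numColors-run p r qs (All.map not-p top))) (s≤s topN))

    merge-split : ∀ {j′ t} (x : Stage s (suc c) (suc j′) t) r (run≡ : runLength p (parts x) ≡ r) →
      merge (split x r run≡) ≡ x
    merge-split (stage _  _ _ _ _ _ _ _) zero    run≡ = refl
    merge-split x@(stage ps _ _ _ _ _ _ _) (suc r) run≡ = stage-≡ (begin
        replicate (suc r) p ++ parts (dropRun x r (afterRun p ps) _ (sym (decompose ps run≡)) _)
      ≡⟨ cong (replicate (suc r) p ++_) (dropRun-parts x r (afterRun p ps) _ (sym (decompose ps run≡)) _) ⟩
        replicate (suc r) p ++ afterRun p ps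
      ≡⟨ decompose ps run≡ ⟩
        ps
      ∎)
      where open ≡-Reasoning

    runs-≡ : ∀ {j′ t} {i i′ : Fin (suc t)} {u : RunOf s (toℕ i)} {u′ : RunOf s (toℕ i′)}
      {z : Stage s c j′ (t ∸ toℕ i)} {z′ : Stage s c j′ (t ∸ toℕ i′)} →
      i ≡ i′ → proj₁ u ≡ proj₁ u′ → parts z ≡ parts z′ →
      (Σ (Fin (suc t)) (λ i → RunOf s (toℕ i) × Stage s c j′ (t ∸ toℕ i)) ∋ (i , u , z)) ≡ (i′ , u′ , z′)
    runs-≡ {i = i} {u = r , e} {.r , e′} refl refl parts≡ =
      cong (i ,_) (cong₂ _,_ (cong (r ,_) (ℕP.≡-irrelevant e e′)) (stage-≡ parts≡))

    split-merge : ∀ {j′ t} (y : Split j′ t) r (run≡ : runLength p (parts (merge y)) ≡ r) →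
      split (merge y) r run≡ ≡ y
    split-merge (inj₁ (stage _ _ _ _ _ _ _ _)) zero run≡ = refl
    split-merge (inj₁ (stage ps _ _ _ top _ _ _)) (suc r) run≡ =
      Irrelevant.⊥-elim (ℕP.0≢1+n (trans (sym (runLength-run p 0 ps (avoids-headNot p (All.map not-p top)))) run≡))
    split-merge (inj₂ (i , (r , i≡) , stage qs _ _ _ top _ _ _)) zero run≡ =
      Irrelevant.⊥-elim (ℕP.0≢1+n (trans (sym run≡) (runLength-run p (suc r) qs (avoids-headNot p (All.map not-p top)))))
    split-merge {t = t} z@(inj₂ (i , (r , i≡) , stage qs _ _ _ top _ _ _)) (suc r′) run≡ =
      cong inj₂ (runs-≡ (FinP.toℕ-injective (trans (FinP.toℕ-fromℕ< fits) (trans (cong (λ m → suc m ℕ.* s) r′≡r) (sym i≡))))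
                        r′≡r (trans (dropRun-parts y r′ (afterRun p run++qs) (afterRun-headNot p run++qs) (sym (decompose run++qs run≡)) _) afterRun≡))
      where
      r′≡r : r′ ≡ r
      r′≡r = ℕP.suc-injective (trans (sym run≡)
        (recompute (_ ℕ.≟ _) (runLength-run p (suc r) qs (avoids-headNot p (All.map not-p top)))))
      fits : suc r′ ℕ.* s < suc t
      fits = subst (_< suc t) (trans i≡ (cong (λ m → suc m ℕ.* s) (sym r′≡r))) (FinP.toℕ<n i)
      y : Stage s (suc c) (suc _) t
      y = merge z
      run++qs : List (Part k)
      run++qs = replicate (suc r) p ++ qs
      afterRun≡ : afterRun p run++qs ≡ qs
      afterRun≡ = recompute (ListP.≡-dec _≟ₚ_ _ _) (afterRun-run p (suc r) qs (avoids-headNot p (All.map not-p top)))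

    addColour : ∀ {j′ t} → Stage s (suc c) (suc j′) t ↔ Split j′ t
    addColour = mk↔ₛ′ (λ x → split x _ refl) merge (λ y → split-merge y _ refl) (λ x → merge-split x _ refl)

  -- (k,j)-coloured partitions of N are exactly the stages with n = N, c = k
  -- and j′ = j: every part has size ≤ N, so the colour bound for sizes
  -- above N holds trivially.
  partitions↔stage : ∀ N → KJPartition k j N ↔ Stage N k j N
  partitions↔stage N = mk↔ₛ′ to from (λ _ → refl) (λ { record { parts = _ } → refl })
    where
    part≤sum : ∀ (ps : List (Part k)) → All (λ q → size q ≤ sum (map size ps)) ps
    part≤sum []       = []
    part≤sum (q ∷ ps) = ℕP.m≤m+n (size q) _ ∷ All.map (λ q≤ → ℕP.≤-trans q≤ (ℕP.m≤n+m _ (size q))) (part≤sum ps)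
    to : KJPartition k j N → Stage N k j N
    to record { parts = ps ; positive = pos ; decreasing = srt ; sizeSum = sm ; colorBound = bound } =
      stage ps pos (subst (λ m → All (λ q → size q ≤ m) ps) sm (part≤sum ps)) srt
        (All.tabulate (λ {q} _ _ → FinP.toℕ<n (proj₂ q))) sm (λ a _ → bound a) (bound N)
    everySize : ∀ (ps : List (Part k)) → All (λ q → size q ≤ N) ps →
      (∀ a → a < N → numColors a ps ≤ j) → numColors N ps ≤ j → ∀ a → numColors a ps ≤ j
    everySize ps bnd low top a with ℕP.<-cmp a N
    ... | tri< a<N _ _ = low a a<N
    ... | tri≈ _ refl _ = top
    ... | tri> _ _ N<a = subst (_≤ j) (sym (numColors-none a
          (All.map (λ q≤N size≡a → ℕP.<-irrefl refl (ℕP.≤-trans N<a (subst (_≤ N) size≡a q≤N))) bnd))) z≤n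
    from : Stage N k j N → KJPartition k j N
    from (stage ps pos bnd srt _ sm low top) = record
      { parts = ps ; positive = pos ; decreasing = srt ; sizeSum = sm ; colorBound = everySize ps bnd low top }

  runCount : ℕ → ℕ → ℕ
  runCount s i = if ⌊ s ℕ.≤? i ⌋ then (if ⌊ s ∣? (i ∸ s) ⌋ then 1 else 0) else 0

  runCount-series : ∀ s i → + runCount s i ≡ runSeries s i
  runCount-series s i with s ℕ.≤? i
  ... | no  s≰i = sym (qpow-shift-low s (invOneMinusQ s) (ℕP.≰⇒> s≰i))
  ... | yes s≤i = trans multiple (sym (qpow-shift s (invOneMinusQ s) s≤i))
    where
    multiple : + (if ⌊ s ∣? (i ∸ s) ⌋ then 1 else 0) ≡ invOneMinusQ s (i ∸ s)
    multiple with s ∣? (i ∸ s)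
    ... | yes _ = refl
    ... | no  _ = refl

  Fin0↔ : ∀ {A : Set} → (A → ⊥) → Fin 0 ↔ A
  Fin0↔ empty = mk↔ₛ′ (λ ()) (λ a → ⊥-elim (empty a)) (λ a → ⊥-elim (empty a)) (λ ())

  Fin1↔ : ∀ {A : Set} (a : A) → (∀ (b : A) → b ≡ a) → Fin 1 ↔ A
  Fin1↔ a unique = mk↔ₛ′ (λ _ → a) (λ _ → Fin.zero) (λ b → sym (unique b)) (λ { Fin.zero → refl ; (Fin.suc ()) })

  runCount↔ : ∀ n i → Fin (runCount (suc n) i) ↔ RunOf (suc n) i
  runCount↔ n i with suc n ℕ.≤? i
  ... | no s≰i = Fin0↔ (λ { (r , i≡) → s≰i (subst (suc n ≤_) (sym i≡) (ℕP.m≤m+n (suc n) (r ℕ.* suc n))) })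
  ... | yes s≤i with suc n ∣? (i ∸ suc n)
  ...   | no  s∤ = Fin0↔ (λ { (r , i≡) → s∤ (divides r (trans (cong (_∸ suc n) i≡) (ℕP.m+n∸m≡n (suc n) (r ℕ.* suc n)))) })
  ...   | yes (divides q i∸s≡) = Fin1↔ (q , i≡) unique
    where
    i≡ : i ≡ suc q ℕ.* suc n
    i≡ = trans (sym (ℕP.m+[n∸m]≡n s≤i)) (cong (suc n ℕ.+_) i∸s≡)
    unique : ∀ (u : RunOf (suc n) i) → u ≡ (q , i≡)
    unique (r , i≡′) with ℕP.*-cancelʳ-≡ (suc r) (suc q) (suc n) (trans (sym i≡′) i≡)
    ... | refl = cong (q ,_) (ℕP.≡-irrelevant i≡′ i≡)

  Fin-⊎ : ∀ {a b} {A B : Set} → Fin a ↔ A → Fin b ↔ B → Fin (a ℕ.+ b) ↔ (A ⊎ B)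
  Fin-⊎ a↔A b↔B = ↔-trans FinP.+↔⊎ (a↔A ⊎-↔ b↔B)

  Fin-× : ∀ {a b} {A B : Set} → Fin a ↔ A → Fin b ↔ B → Fin (a ℕ.* b) ↔ (A × B)
  Fin-× a↔A b↔B = ↔-trans FinP.*↔× (a↔A ×-↔ b↔B)

  sumℕ : ℕ → (ℕ → ℕ) → ℕ
  sumℕ zero    f = 0
  sumℕ (suc t) f = f 0 ℕ.+ sumℕ t (f ∘ suc)

  sumℕ-sumℤ : ∀ t f → + sumℕ t f ≡ sumℤ t (λ i → + f i)
  sumℕ-sumℤ zero    f = refl
  sumℕ-sumℤ (suc t) f = trans (ℤP.pos-+ (f 0) (sumℕ t (f ∘ suc)))
    (trans (cong (λ x → + f 0 ℤ.+ x) (sumℕ-sumℤ t (f ∘ suc))) (sym (sumℤ-head t (λ i → + f i))))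

  Fin-Σ : ∀ t (f : ℕ → ℕ) (B : ℕ → Set) → (∀ i → Fin (f i) ↔ B i) → Fin (sumℕ t f) ↔ Σ (Fin t) (B ∘ toℕ)
  Fin-Σ zero    f B _   = Fin0↔ (λ { (() , _) })
  Fin-Σ (suc t) f B f↔B = ↔-trans (Fin-⊎ (f↔B 0) (Fin-Σ t (f ∘ suc) (B ∘ suc) (f↔B ∘ suc))) split-zero
    where
    split-zero : (B 0 ⊎ Σ (Fin t) (B ∘ suc ∘ toℕ)) ↔ Σ (Fin (suc t)) (B ∘ toℕ)
    split-zero = mk↔ₛ′ (λ { (inj₁ b) → Fin.zero , b ; (inj₂ (i , b)) → Fin.suc i , b })
                       (λ { (Fin.zero , b) → inj₁ b ; (Fin.suc i , b) → inj₂ (i , b) })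
                       (λ { (Fin.zero , b) → refl ; (Fin.suc i , b) → refl })
                       (λ { (inj₁ b) → refl ; (inj₂ (i , b)) → refl })

  count : ℕ → ℕ → ℕ → ℕ → ℕ
  count zero    c       j′       zero    = 1
  count zero    c       j′       (suc t) = 0
  count (suc n) zero    j′       t = count n k j t
  count (suc n) (suc c) zero     t = count (suc n) c zero t
  count (suc n) (suc c) (suc j′) t =
    count (suc n) c (suc j′) t ℕ.+ sumℕ (suc t) (λ i → runCount (suc n) i ℕ.* count (suc n) c j′ (t ∸ i))

  count↔stage : ∀ n c j′ t → c ≤ k → Fin (count n c j′ t) ↔ Stage n c j′ t
  count↔stage zero    c       j′       zero    _ =
    Fin1↔ emptyStage (λ x → stage-≡ (stage₀-empty x))
  count↔stage zero    c       j′       (suc t) _ = Fin0↔ noStage₀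
  count↔stage (suc n) zero    j′       t _ = ↔-trans (count↔stage n k j t ℕP.≤-refl) (↔-sym noTopColours)
  count↔stage (suc n) (suc c) zero     t c<k =
    ↔-trans (count↔stage (suc n) c zero t (ℕP.<⇒≤ c<k)) (↔-sym noTopBudget)
  count↔stage (suc n) (suc c) (suc j′) t c<k = ↔-trans
    (Fin-⊎ (count↔stage (suc n) c (suc j′) t (ℕP.<⇒≤ c<k))
           (Fin-Σ (suc t) _ (λ i → RunOf (suc n) i × Stage (suc n) c j′ (t ∸ i))
                  (λ i → Fin-× (runCount↔ n i) (count↔stage (suc n) c j′ (t ∸ i) (ℕP.<⇒≤ c<k)))))
    (↔-sym (AddColour.addColour n c c<k))

  countSeries : ℕ → ℕ → ℕ → PS
  countSeries n c j′ t = + count n c j′ t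

  countSeries-addColour : ∀ n c j′ →
    countSeries (suc n) (suc c) (suc j′) ≈ countSeries (suc n) c (suc j′) +ₚ (runSeries (suc n) *ₚ countSeries (suc n) c j′)
  countSeries-addColour n c j′ .coeff t = begin
      + (count (suc n) c (suc j′) t ℕ.+ sumℕ (suc t) f)
    ≡⟨ ℤP.pos-+ (count (suc n) c (suc j′) t) (sumℕ (suc t) f) ⟩
      + count (suc n) c (suc j′) t ℤ.+ + sumℕ (suc t) f
    ≡⟨ cong (λ x → + count (suc n) c (suc j′) t ℤ.+ x) (sumℕ-sumℤ (suc t) f) ⟩
      + count (suc n) c (suc j′) t ℤ.+ sumℤ (suc t) (λ i → + f i)
    ≡⟨ cong (λ x → + count (suc n) c (suc j′) t ℤ.+ x) (sumℤ-cong (suc t) (λ i _ →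
         trans (ℤP.pos-* (runCount (suc n) i) (count (suc n) c j′ (t ∸ i)))
               (cong (ℤ._* countSeries (suc n) c j′ (t ∸ i)) (runCount-series (suc n) i)))) ⟩
      + count (suc n) c (suc j′) t ℤ.+ (runSeries (suc n) *ₚ countSeries (suc n) c j′) t
    ∎
    where
    open ≡-Reasoning
    f : ℕ → ℕ
    f i = runCount (suc n) i ℕ.* count (suc n) c j′ (t ∸ i)

  countSeries-level : ∀ n → countSeries n k j ≈ finProd (factor1 k j) n →
    ∀ c j′ → countSeries (suc n) c j′ ≈ finProd (factor1 k j) n *ₚ factor1 c j′ (suc n)
  countSeries-level n below zero j′ = ≈-trans below (≈-trans (≈-sym (*-identityʳ F))
    (*-congˡ F (≈-sym (factor1-no-colours j′ (suc n)))))
    where F : PS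
          F = finProd (factor1 k j) n
  countSeries-level n below (suc c) zero = countSeries-level n below c zero
  countSeries-level n below (suc c) (suc j′) = begin
      countSeries (suc n) (suc c) (suc j′)
    ≈⟨ countSeries-addColour n c j′ ⟩
      countSeries (suc n) c (suc j′) +ₚ (y *ₚ countSeries (suc n) c j′)
    ≈⟨ +-cong (countSeries-level n below c (suc j′)) (*-congˡ y (countSeries-level n below c j′)) ⟩
      (F *ₚ factor1 c (suc j′) (suc n)) +ₚ (y *ₚ (F *ₚ factor1 c j′ (suc n)))
    ≈⟨ +-congˡ (F *ₚ factor1 c (suc j′) (suc n)) (x∙yz≈y∙xz y F (factor1 c j′ (suc n))) ⟩
      (F *ₚ factor1 c (suc j′) (suc n)) +ₚ (F *ₚ (y *ₚ factor1 c j′ (suc n)))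
    ≈⟨ ≈-sym (*-distribˡ F (factor1 c (suc j′) (suc n)) (y *ₚ factor1 c j′ (suc n))) ⟩
      F *ₚ (factor1 c (suc j′) (suc n) +ₚ (y *ₚ factor1 c j′ (suc n)))
    ≈⟨ *-congˡ F (≈-sym (factor1-recurrence c j′ (suc n))) ⟩
      F *ₚ factor1 (suc c) (suc j′) (suc n)
    ∎
    where
    open ≈-Reasoning
    F y : PS
    F = finProd (factor1 k j) n
    y = runSeries (suc n)

  countSeries-partialProduct : ∀ n → countSeries n k j ≈ finProd (factor1 k j) n
  countSeries-partialProduct zero    .coeff zero    = refl
  countSeries-partialProduct zero    .coeff (suc t) = refl
  countSeries-partialProduct (suc n) = countSeries-level n (countSeries-partialProduct n) k j

open ColouredPartitions

-- m is the number of stages of level N, and infProd (factor1 k j) N is the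
-- N-th coefficient of the N-th partial product.
mainTheorem1 : (k j : ℕ) → 1 ≤ j → j ≤ k → (N : ℕ) →
    Σ ℕ (λ m →
    (Fin m ↔ KJPartition k j N)
    × (+ m ≡ infProd (factor1 k j) N)
    × (infProd (factor1 k j) N ≡ ((invPoch ^ₚ j) *ₚ infProd (factor2 k j)) N)
    × (infProd (factor1 k j) N ≡ ((invPoch ^ₚ j) *ₚ infProd (factor3 k j)) N))
mainTheorem1 k j _ j≤k N =
  count k j N k j N ,
  ↔-trans (count↔stage k j N k j N ℕP.≤-refl) (↔-sym (partitions↔stage k j N)) ,
  coeff (countSeries-partialProduct k j N) N ,
  productForm₂ k j j≤k N ,
  productForm₃ k j j≤k N
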